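{- Let $G,H$ be finite alphabets, $S\subseteq G^n$, and $f:S\to H$ a non-constant partial function. Then $\mathrm{fbs}(f)\le\mathrm{CA}_1(f)$.
   Context: For $x\in S$, $x_i$ is its $i$-th letter. A set $B\subseteq[n]$ is a sensitive block of $x\in S$ if there is $y\in S$ with $f(y)\neq f(x)$ and $B=\{i:x_i\neq y_i\}$; let $\mathcal B_x$ be their set. $\mathrm{fbs}(f,x)=\max\sum_{B\in\mathcal B_x}w(B)$ over $w:\mathcal B_x\to[0,1]$ with $\sum_{B\ni i}w(B)\le1$ for every $i\in[n]$; $\mathrm{fbs}(f)=\max_x\mathrm{fbs}(f,x)$. Rank-1 relational adversary: over $u,v:S\to\mathbb{R}_{\ge0}$ with $u(x)v(y)=0$ whenever $f(x)=f(y)$ (not all products zero), with $X=\{u>0\}$, $Y=\{v>0\}$, $\theta(x,i)=\frac{\sum_{y'\in Y}v(y')}{\sum_{y'\in Y:x_i\neq y'_i}v(y')}$, $\theta(y,i)=\frac{\sum_{x'\in X}u(x')}{\sum_{x'\in X:x'_i\neq y_i}u(x')}$, $\mathrm{CA}_1(f)=\max_{u,v}\min\{\max\{\theta(x,i),\theta(y,i)\}:x\in X,y\in Y,i\in[n],u(x)v(y)>0,x_i\neq y_i\}$.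
   Formalization: The weights w defining fbs(f,x) take rational values in [0,1], and the functions u, v of the rank-1 adversary take nonnegative rational values rather than real ones. -}

module Defs where

open import Data.Nat using (ℕ; zero; suc)
open import Data.Fin using (Fin)
open import Data.Fin.Properties renaming (_≟_ to _≟ᶠ_)
open import Data.Bool using (Bool; true; false; if_then_else_; _∧_; not)
open import Data.Vec using (Vec; []; _∷_; lookup; zipWith)
import Data.Vec.Properties as VP
open import Data.List using (List; []; _∷_; map; concatMap; filter; foldr; allFin)
open import Data.Bool.ListAction using (any)
open import Data.List.Relation.Unary.Any using (Any)
open import Data.Maybe using (Maybe; just; nothing)
import Data.Maybe.Properties as MP
open import Data.Product using (Σ; ∃; _×_; _,_)
open import Data.Rational using (ℚ; 0ℚ; 1ℚ; _+_; _*_; _≤_; _<_; _÷_; _⊔_)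
open import Data.Rational.Properties using () renaming (_≟_ to _≟ℚ_)
open import Relation.Nullary using (¬_; yes; no; does)
open import Relation.Nullary.Decidable using (⌊_⌋)
open import Relation.Binary.PropositionalEquality using (_≡_; _≢_)

allVecs : {A : Set} → List A → (n : ℕ) → List (Vec A n)
allVecs xs zero    = [] ∷ []
allVecs xs (suc n) = concatMap (λ a → map (a ∷_) (allVecs xs n)) xs

Word : ℕ → ℕ → Set
Word g n = Vec (Fin g) n

allWords : (g n : ℕ) → List (Word g n)
allWords g n = allVecs (allFin g) n

-- Subsets of [n] as characteristic vectors.
Block : ℕ → Set
Block n = Vec Bool n

allBlocks : (n : ℕ) → List (Block n)
allBlocks n = allVecs (true ∷ false ∷ []) n

_∈B_ : {n : ℕ} → Fin n → Block n → Bool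
i ∈B B = lookup B i

-- A partial function f : S → H with S ⊆ G^n, H = Fin h, encoded as
-- a total map into Maybe H; S is the domain {x | f x ≢ nothing}.
PFun : ℕ → ℕ → ℕ → Set
PFun g n h = Word g n → Maybe (Fin h)

diff : {g n : ℕ} → Word g n → Word g n → Block n
diff x y = zipWith (λ a b → not ⌊ a ≟ᶠ b ⌋) x y

sensPartner : {g n h : ℕ} → PFun g n h → Word g n → Word g n → Bool
sensPartner f x y with f y
... | nothing = false
... | just b  = not ⌊ MP.≡-dec _≟ᶠ_ (just b) (f x) ⌋

isSensitive : {g n h : ℕ} → PFun g n h → Word g n → Block n → Bool
isSensitive {g} {n} f x B =
  any (λ y → sensPartner f x y ∧ ⌊ VP.≡-dec Data.Bool._≟_ (diff x y) B ⌋) (allWords g n)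
  where import Data.Bool

sensBlocks : {g n h : ℕ} → PFun g n h → Word g n → List (Block n)
sensBlocks f x = filter (λ B → isSensitive f x B Data.Bool.≟ true) (allBlocks _)
  where import Data.Bool

Σ[_]_ : {A : Set} → List A → (A → ℚ) → ℚ
Σ[ xs ] w = foldr (λ a r → w a + r) 0ℚ xs

Σ[_∣_]_ : {A : Set} → List A → (A → Bool) → (A → ℚ) → ℚ
Σ[ xs ∣ p ] w = Σ[ xs ] (λ a → if p a then w a else 0ℚ)

FeasibleWeight : {g n h : ℕ} → PFun g n h → Word g n → (Block n → ℚ) → Set
FeasibleWeight f x w =
  (∀ B → isSensitive f x B ≡ true → (0ℚ ≤ w B) × (w B ≤ 1ℚ)) ×
  (∀ i → Σ[ sensBlocks f x ∣ (λ B → i ∈B B) ] w ≤ 1ℚ)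

blockValue : {g n h : ℕ} → PFun g n h → Word g n → (Block n → ℚ) → ℚ
blockValue f x w = Σ[ sensBlocks f x ] w

-- Total division (a / 0 := 0); only ever applied to nonzero denominators
-- in the theorem below.
_/ₜ_ : ℚ → ℚ → ℚ
a /ₜ b with b ≟ℚ 0ℚ
... | yes _ = 0ℚ
... | no b≢0 = _÷_ a b {{Data.Rational.≢-nonZero b≢0}}
  where import Data.Rational

-- θ(x,i) = (∑_{y'∈Y} v(y')) / (∑_{y'∈Y, x_i ≠ y'_i} v(y'));
-- summing over all of G^n is the same as summing over Y since v vanishes off Y
-- (v ≥ 0 and Y = {v > 0}).
θˣ : {g n : ℕ} → (Word g n → ℚ) → Word g n → Fin n → ℚ
θˣ {g} {n} v x i =
  (Σ[ allWords g n ] v) /ₜ (Σ[ allWords g n ∣ (λ y' → not ⌊ lookup x i ≟ᶠ lookup y' i ⌋) ] v)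

θʸ : {g n : ℕ} → (Word g n → ℚ) → Word g n → Fin n → ℚ
θʸ {g} {n} u y i =
  (Σ[ allWords g n ] u) /ₜ (Σ[ allWords g n ∣ (λ x' → not ⌊ lookup x' i ≟ᶠ lookup y i ⌋) ] u)

-- (u, v) is an admissible pair for CA₁(f): u, v : S → ℝ≥0 (here: functions on G^n
-- that are ≥ 0 and vanish outside S), u(x)v(y) = 0 whenever f(x) = f(y),
-- and not all products u(x)v(y) vanish.
Admissible : {g n h : ℕ} → PFun g n h → (Word g n → ℚ) → (Word g n → ℚ) → Set
Admissible f u v =
  (∀ x → 0ℚ ≤ u x) × (∀ y → 0ℚ ≤ v y) ×
  (∀ x → f x ≡ nothing → u x ≡ 0ℚ) × (∀ y → f y ≡ nothing → v y ≡ 0ℚ) ×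
  (∀ x y b → f x ≡ just b → f y ≡ just b → u x * v y ≡ 0ℚ) ×
  (∃ λ x → ∃ λ y → 0ℚ < u x * v y)

-- The objective of (u,v) is at least c, i.e. c ≤ min{ max{θ(x,i),θ(y,i)} :
-- x ∈ X, y ∈ Y, i ∈ [n], u(x)v(y) > 0, x_i ≠ y_i }.
AdversaryBound : {g n : ℕ} → (Word g n → ℚ) → (Word g n → ℚ) → ℚ → Set
AdversaryBound u v c =
  ∀ x y i → 0ℚ < u x * v y → lookup x i ≢ lookup y i → c ≤ θˣ v x i ⊔ θʸ u y i

NonConstant : {g n h : ℕ} → PFun g n h → Set
NonConstant f = ∃ λ x → ∃ λ y → ∃ λ a → ∃ λ b → f x ≡ just a × f y ≡ just b × a ≢ b

-- The adversary weights everything on the single input x: u is the point mass at x,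
-- and v spreads the weight w(B) of each sensitive block B evenly over the partners y
-- of x with {i : xᵢ ≠ yᵢ} = B. Then ∑ v is the packing value of w, while for every
-- coordinate i the v-mass of the partners differing from x at i is the load of w at i,
-- at most 1; hence θ(x,i) ≥ ∑ v. If ∑ v = 0 the value of w is at most 0, and any
-- admissible pair (two inputs with different values) will do.
module Submission where

open import Defs
open import Algebra.Bundles using (CommutativeMonoid)
import Algebra.Properties.CommutativeSemigroup as CommSemigroupProperties
open import Data.Bool using (Bool; true; false; if_then_else_; _∧_; not)
import Data.Bool as Bool
open import Data.Bool.ListAction using (any)
open import Data.Empty using (⊥-elim)
open import Data.Fin using (Fin)
open import Data.Fin.Properties using () renaming (_≟_ to _≟ᶠ_)
open import Data.List using (List; []; _∷_; map; filter; _++_)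
open import Data.List.Membership.Propositional using (_∈_)
open import Data.List.Membership.Propositional.Properties using (∈-map⁺; ∈-concat⁺′; ∈-allFin)
open import Data.List.Relation.Unary.Any using (here; there)
open import Data.Maybe using (just; nothing)
import Data.Maybe.Properties as Maybe
open import Data.Nat using (ℕ; zero; suc)
open import Data.Product using (∃; _×_; _,_; proj₁)
open import Data.Rational using (ℚ; 0ℚ; 1ℚ; _+_; _*_; _≤_; _<_; 1/_; ≢-nonZero; positive; nonNegative)
open import Data.Rational.Properties
open import Data.Vec using (Vec; []; _∷_; lookup)
import Data.Vec.Properties as Vec
open import Relation.Binary.Definitions using (DecidableEquality)
open import Relation.Binary.PropositionalEquality
open import Relation.Nullary using (¬_; Dec; yes; no)
open import Relation.Nullary.Decidable using (⌊_⌋; isYes≗does; does-⇔; dec-true; dec-false)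
open import Function.Bundles using (mk⇔)

open CommSemigroupProperties (CommutativeMonoid.commutativeSemigroup +-0-commutativeMonoid)
  using (interchange)

0<1 : 0ℚ < 1ℚ
0<1 = positive⁻¹ 1ℚ

⌊⌋-true : ∀ {A : Set} (a? : Dec A) → A → ⌊ a? ⌋ ≡ true
⌊⌋-true a? a = trans (isYes≗does a?) (dec-true a? a)

⌊⌋-false : ∀ {A : Set} (a? : Dec A) → ¬ A → ⌊ a? ⌋ ≡ false
⌊⌋-false a? ¬a = trans (isYes≗does a?) (dec-false a? ¬a)

if-nonneg : ∀ (b : Bool) {p : ℚ} → 0ℚ ≤ p → 0ℚ ≤ (if b then p else 0ℚ)
if-nonneg true  0≤p = 0≤p
if-nonneg false _   = ≤-refl

module _ {A : Set} where

  Σ-cong : ∀ (xs : List A) {F G : A → ℚ} → (∀ a → F a ≡ G a) → Σ[ xs ] F ≡ Σ[ xs ] G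
  Σ-cong []       F≡G = refl
  Σ-cong (a ∷ xs) F≡G = cong₂ _+_ (F≡G a) (Σ-cong xs F≡G)

  Σ-zero : ∀ (xs : List A) {F : A → ℚ} → (∀ a → F a ≡ 0ℚ) → Σ[ xs ] F ≡ 0ℚ
  Σ-zero []       F≡0 = refl
  Σ-zero (a ∷ xs) F≡0 = trans (cong₂ _+_ (F≡0 a) (Σ-zero xs F≡0)) (+-identityˡ 0ℚ)

  Σ-+ : ∀ (xs : List A) (F G : A → ℚ) → Σ[ xs ] (λ a → F a + G a) ≡ Σ[ xs ] F + Σ[ xs ] G
  Σ-+ []       F G = refl
  Σ-+ (a ∷ xs) F G =
    trans (cong (F a + G a +_) (Σ-+ xs F G)) (interchange (F a) (G a) (Σ[ xs ] F) (Σ[ xs ] G))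

  Σ-++ : ∀ (xs ys : List A) (F : A → ℚ) → Σ[ xs ++ ys ] F ≡ Σ[ xs ] F + Σ[ ys ] F
  Σ-++ []       ys F = sym (+-identityˡ _)
  Σ-++ (a ∷ xs) ys F = trans (cong (F a +_) (Σ-++ xs ys F)) (sym (+-assoc (F a) _ _))

  Σ-nonneg : ∀ (xs : List A) {F : A → ℚ} → (∀ a → 0ℚ ≤ F a) → 0ℚ ≤ Σ[ xs ] F
  Σ-nonneg []       F≥0 = ≤-refl
  Σ-nonneg (a ∷ xs) F≥0 = +-mono-≤ (F≥0 a) (Σ-nonneg xs F≥0)

  Σ∣-nonneg : ∀ (xs : List A) (p : A → Bool) {F : A → ℚ} → (∀ a → 0ℚ ≤ F a) →
              0ℚ ≤ Σ[ xs ∣ p ] F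
  Σ∣-nonneg xs p F≥0 = Σ-nonneg xs (λ a → if-nonneg (p a) (F≥0 a))

  term≤Σ : ∀ (xs : List A) {F : A → ℚ} → (∀ a → 0ℚ ≤ F a) → ∀ {a} → a ∈ xs → F a ≤ Σ[ xs ] F
  term≤Σ (a ∷ xs) {F} F≥0 (here refl) =
    subst (_≤ F a + Σ[ xs ] F) (+-identityʳ (F a)) (+-monoʳ-≤ (F a) (Σ-nonneg xs F≥0))
  term≤Σ (b ∷ xs) {F} F≥0 (there a∈xs) =
    subst (_≤ F b + Σ[ xs ] F) (+-identityˡ _) (+-mono-≤ (F≥0 b) (term≤Σ xs F≥0 a∈xs))

  term≤Σ∣ : ∀ (xs : List A) (p : A → Bool) {F : A → ℚ} → (∀ a → 0ℚ ≤ F a) →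
            ∀ {a} → a ∈ xs → p a ≡ true → F a ≤ Σ[ xs ∣ p ] F
  term≤Σ∣ xs p {F} F≥0 {a} a∈xs pa =
    subst (λ b → (if b then F a else 0ℚ) ≤ Σ[ xs ∣ p ] F) pa
      (term≤Σ xs (λ b → if-nonneg (p b) (F≥0 b)) a∈xs)

  Σ>0⇒term>0 : ∀ (xs : List A) (F : A → ℚ) → 0ℚ < Σ[ xs ] F → ∃ λ a → 0ℚ < F a
  Σ>0⇒term>0 []       F Σ>0 = ⊥-elim (<-irrefl refl Σ>0)
  Σ>0⇒term>0 (a ∷ xs) F Σ>0 with 0ℚ <? F a | 0ℚ <? Σ[ xs ] F
  ... | yes Fa>0 | _      = a , Fa>0
  ... | no _     | yes Σ′>0 = Σ>0⇒term>0 xs F Σ′>0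
  ... | no Fa≯0  | no Σ′≯0 = ⊥-elim (<-irrefl refl (<-≤-trans Σ>0 (+-mono-≤ (≮⇒≥ Fa≯0) (≮⇒≥ Σ′≯0))))

  any-true : ∀ (xs : List A) (p : A → Bool) {a : A} → a ∈ xs → p a ≡ true → any p xs ≡ true
  any-true (b ∷ xs) p (here refl) pa rewrite pa = refl
  any-true (b ∷ xs) p (there a∈xs) pa with p b
  ... | true  = refl
  ... | false = any-true xs p a∈xs pa

  count : List A → (A → Bool) → ℚ
  count xs p = Σ[ xs ∣ p ] (λ _ → 1ℚ)

  Σ∣-const : ∀ (xs : List A) (p : A → Bool) (c : ℚ) → Σ[ xs ∣ p ] (λ _ → c) ≡ c * count xs p
  Σ∣-const []       p c = sym (*-zeroʳ c)
  Σ∣-const (a ∷ xs) p c with p a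
  ... | true  = trans (cong₂ _+_ (sym (*-identityʳ c)) (Σ∣-const xs p c))
                      (sym (*-distribˡ-+ c 1ℚ (count xs p)))
  ... | false = trans (+-identityˡ _) (trans (Σ∣-const xs p c) (cong (c *_) (sym (+-identityˡ _))))

  count≡0 : ∀ (xs : List A) (p : A → Bool) → any p xs ≡ false → count xs p ≡ 0ℚ
  count≡0 []       p _ = refl
  count≡0 (a ∷ xs) p none with p a
  ... | false = trans (+-identityˡ _) (count≡0 xs p none)

  count>0 : ∀ (xs : List A) (p : A → Bool) → any p xs ≡ true → 0ℚ < count xs p
  count>0 (a ∷ xs) p some with p a
  ... | true  = <-≤-trans 0<1 (subst (_≤ 1ℚ + count xs p) (+-identityʳ 1ℚ)
                  (+-monoʳ-≤ 1ℚ (Σ∣-nonneg xs p (λ _ → <⇒≤ 0<1))))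
  ... | false = subst (0ℚ <_) (sym (+-identityˡ _)) (count>0 xs p some)

  Σ∣-filter : ∀ (xs : List A) (b p : A → Bool) (F : A → ℚ) →
              Σ[ filter (λ a → b a Bool.≟ true) xs ∣ p ] F ≡ Σ[ xs ∣ b ] (λ a → if p a then F a else 0ℚ)
  Σ∣-filter []       b p F = refl
  Σ∣-filter (a ∷ xs) b p F with b a
  ... | true  = cong ((if p a then F a else 0ℚ) +_) (Σ∣-filter xs b p F)
  ... | false = trans (Σ∣-filter xs b p F) (sym (+-identityˡ _))

Σ-map : ∀ {A B : Set} (xs : List A) (h : A → B) (F : B → ℚ) → Σ[ map h xs ] F ≡ Σ[ xs ] (λ a → F (h a))
Σ-map []       h F = refl
Σ-map (a ∷ xs) h F = cong (F (h a) +_) (Σ-map xs h F)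

Σ-comm : ∀ {A B : Set} (xs : List A) (ys : List B) (T : A → B → ℚ) →
         Σ[ xs ] (λ a → Σ[ ys ] (T a)) ≡ Σ[ ys ] (λ b → Σ[ xs ] (λ a → T a b))
Σ-comm []       ys T = sym (Σ-zero ys (λ _ → refl))
Σ-comm (a ∷ xs) ys T = trans (cong (Σ[ ys ] (T a) +_) (Σ-comm xs ys T)) (sym (Σ-+ ys (T a) _))

/ₜ-*-cancel : ∀ p {q} → q ≢ 0ℚ → (p /ₜ q) * q ≡ p
/ₜ-*-cancel p {q} q≢0 with q ≟ 0ℚ
... | yes q≡0 = ⊥-elim (q≢0 q≡0)
... | no  _   = trans (*-assoc p (1/ q) q)
                      (trans (cong (p *_) (*-inverseˡ q)) (*-identityʳ p))
  where instance _ = ≢-nonZero q≢0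

≤-/ₜ-intro : ∀ {p q r} → 0ℚ < q → r * q ≤ p → r ≤ p /ₜ q
≤-/ₜ-intro {p} {q} 0<q rq≤p = *-cancelʳ-≤-pos q {{positive 0<q}}
  (subst (_ ≤_) (sym (/ₜ-*-cancel p (≢-sym (<⇒≢ 0<q)))) rq≤p)

/ₜ-nonneg : ∀ {p q} → 0ℚ ≤ p → 0ℚ ≤ q → 0ℚ ≤ p /ₜ q
/ₜ-nonneg {p} {q} 0≤p 0≤q with 0ℚ <? q
... | yes 0<q = ≤-/ₜ-intro 0<q (subst (_≤ p) (sym (*-zeroˡ q)) 0≤p)
... | no  0≮q rewrite ≤-antisym (≮⇒≥ 0≮q) 0≤q = ≤-refl

≤-/ₜ : ∀ {p q} → 0ℚ ≤ p → 0ℚ < q → q ≤ 1ℚ → p ≤ p /ₜ q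
≤-/ₜ {p} {q} 0≤p 0<q q≤1 = ≤-/ₜ-intro 0<q
  (subst (p * q ≤_) (*-identityʳ p) (*-monoˡ-≤-nonNeg p {{nonNegative 0≤p}} q≤1))

infix 4 _≟ᵇ_ _≟ʷ_

_≟ᵇ_ : ∀ {n} → DecidableEquality (Block n)
_≟ᵇ_ = Vec.≡-dec Bool._≟_

_≟ʷ_ : ∀ {g n} → DecidableEquality (Word g n)
_≟ʷ_ = Vec.≡-dec _≟ᶠ_

∈-allVecs : ∀ {A : Set} {xs : List A} → (∀ a → a ∈ xs) → ∀ n (v : Vec A n) → v ∈ allVecs xs n
∈-allVecs all zero    []      = here refl
∈-allVecs all (suc n) (a ∷ v) =
  ∈-concat⁺′ (∈-map⁺ (a ∷_) (∈-allVecs all n v)) (∈-map⁺ (λ b → map (b ∷_) (allVecs _ n)) (all a))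

∈-allWords : ∀ {g n} (y : Word g n) → y ∈ allWords g n
∈-allWords {g} {n} = ∈-allVecs ∈-allFin n

Σ-allBlocks-suc : ∀ n (F : Block (suc n) → ℚ) →
  Σ[ allBlocks (suc n) ] F ≡ Σ[ allBlocks n ] (λ B → F (true ∷ B)) + Σ[ allBlocks n ] (λ B → F (false ∷ B))
Σ-allBlocks-suc n F = begin
  Σ[ map (true ∷_) Bs ++ (map (false ∷_) Bs ++ []) ] F
    ≡⟨ Σ-++ (map (true ∷_) Bs) _ F ⟩
  Σ[ map (true ∷_) Bs ] F + Σ[ map (false ∷_) Bs ++ [] ] F
    ≡⟨ cong (Σ[ map (true ∷_) Bs ] F +_) (trans (Σ-++ (map (false ∷_) Bs) [] F) (+-identityʳ _)) ⟩
  Σ[ map (true ∷_) Bs ] F + Σ[ map (false ∷_) Bs ] F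
    ≡⟨ cong₂ _+_ (Σ-map Bs (true ∷_) F) (Σ-map Bs (false ∷_) F) ⟩
  Σ[ Bs ] (λ B → F (true ∷ B)) + Σ[ Bs ] (λ B → F (false ∷ B)) ∎
  where open ≡-Reasoning
        Bs = allBlocks n

⌊∷≟ᵇ∷⌋ : ∀ {n} b (B₀ B : Block n) → ⌊ b ∷ B₀ ≟ᵇ b ∷ B ⌋ ≡ ⌊ B₀ ≟ᵇ B ⌋
⌊∷≟ᵇ∷⌋ b B₀ B = trans (isYes≗does (b ∷ B₀ ≟ᵇ b ∷ B))
  (trans (does-⇔ (mk⇔ Vec.∷-injectiveʳ (cong (b ∷_))) (b ∷ B₀ ≟ᵇ b ∷ B) (B₀ ≟ᵇ B))
         (sym (isYes≗does (B₀ ≟ᵇ B))))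

⌊∷≟ᵇ∷⌋-head : ∀ {n} {b c : Bool} (B₀ B : Block n) → b ≢ c → ⌊ b ∷ B₀ ≟ᵇ c ∷ B ⌋ ≡ false
⌊∷≟ᵇ∷⌋-head {b = b} {c} B₀ B b≢c = ⌊⌋-false (b ∷ B₀ ≟ᵇ c ∷ B) (λ e → b≢c (Vec.∷-injectiveˡ e))

Σ-select-∷ : ∀ {n} b (B₀ : Block n) (F : Block (suc n) → ℚ) →
  Σ[ allBlocks n ] (λ B → if ⌊ b ∷ B₀ ≟ᵇ b ∷ B ⌋ then F (b ∷ B) else 0ℚ) ≡
  Σ[ allBlocks n ∣ (λ B → ⌊ B₀ ≟ᵇ B ⌋) ] (λ B → F (b ∷ B))
Σ-select-∷ {n} b B₀ F = Σ-cong (allBlocks n) (λ B → cong (if_then F (b ∷ B) else 0ℚ) (⌊∷≟ᵇ∷⌋ b B₀ B))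

Σ-select-∷-head : ∀ {n} b c (B₀ : Block n) (F : Block (suc n) → ℚ) → b ≢ c →
  Σ[ allBlocks n ] (λ B → if ⌊ b ∷ B₀ ≟ᵇ c ∷ B ⌋ then F (c ∷ B) else 0ℚ) ≡ 0ℚ
Σ-select-∷-head {n} b c B₀ F b≢c =
  Σ-zero (allBlocks n) (λ B → cong (if_then F (c ∷ B) else 0ℚ) (⌊∷≟ᵇ∷⌋-head B₀ B b≢c))

Σ-allBlocks-select : ∀ {n} (B₀ : Block n) (F : Block n → ℚ) → Σ[ allBlocks n ∣ (λ B → ⌊ B₀ ≟ᵇ B ⌋) ] F ≡ F B₀
Σ-allBlocks-select []               F = +-identityʳ (F [])
Σ-allBlocks-select {suc n} (true ∷ B₀) F =
  trans (Σ-allBlocks-suc n (λ B → if ⌊ true ∷ B₀ ≟ᵇ B ⌋ then F B else 0ℚ))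
        (trans (cong₂ _+_ (trans (Σ-select-∷ true B₀ F) (Σ-allBlocks-select B₀ (λ B → F (true ∷ B))))
                          (Σ-select-∷-head true false B₀ F λ ()))
               (+-identityʳ _))
Σ-allBlocks-select {suc n} (false ∷ B₀) F =
  trans (Σ-allBlocks-suc n (λ B → if ⌊ false ∷ B₀ ≟ᵇ B ⌋ then F B else 0ℚ))
        (trans (cong₂ _+_ (Σ-select-∷-head false true B₀ F λ ())
                          (trans (Σ-select-∷ false B₀ F) (Σ-allBlocks-select B₀ (λ B → F (false ∷ B)))))
               (+-identityˡ _))

pointMass : ∀ {g n} → Word g n → Word g n → ℚ
pointMass z z′ = if ⌊ z′ ≟ʷ z ⌋ then 1ℚ else 0ℚ

pointMass-self : ∀ {g n} (z : Word g n) → pointMass z z ≡ 1ℚ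
pointMass-self z = cong (if_then 1ℚ else 0ℚ) (⌊⌋-true (z ≟ʷ z) refl)

pointMass-nonneg : ∀ {g n} (z z′ : Word g n) → 0ℚ ≤ pointMass z z′
pointMass-nonneg z z′ = if-nonneg ⌊ z′ ≟ʷ z ⌋ (<⇒≤ 0<1)

pointMass-self-* : ∀ {g n} (z : Word g n) (r : ℚ) → pointMass z z * r ≡ r
pointMass-self-* z r = trans (cong (_* r) (pointMass-self z)) (*-identityˡ r)

pointMass-undefined : ∀ {g n h} (f : PFun g n h) {z z′ : Word g n} {a : Fin h} →
  f z ≡ just a → f z′ ≡ nothing → pointMass z z′ ≡ 0ℚ
pointMass-undefined f {z} {z′} fz≡a fz′≡nothing with z′ ≟ʷ z
... | no  _    = refl
... | yes refl with trans (sym fz≡a) fz′≡nothing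
... | ()

pointMass-support : ∀ {g n} (z z′ : Word g n) {r : ℚ} → 0ℚ < pointMass z z′ * r → z′ ≡ z
pointMass-support z z′ {r} 0<u*r with z′ ≟ʷ z
... | yes z′≡z = z′≡z
... | no  _    = ⊥-elim (<-irrefl (sym (*-zeroˡ r)) 0<u*r)

pointMass-admissible : ∀ {g n h} (f : PFun g n h) {z : Word g n} {a : Fin h} {v : Word g n → ℚ} →
  f z ≡ just a → (∀ y → 0ℚ ≤ v y) → (∀ y → f y ≡ nothing → v y ≡ 0ℚ) → (∀ y → f y ≡ just a → v y ≡ 0ℚ) →
  ∀ y → 0ℚ < v y → Admissible f (pointMass z) v
pointMass-admissible f {z} {a} {v} fz≡a v≥0 v-undefined v-sameValue y 0<vy =
  pointMass-nonneg z , v≥0 , (λ _ → pointMass-undefined f fz≡a) , v-undefined , u*v≡0 ,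
  (z , y , subst (0ℚ <_) (sym (pointMass-self-* z (v y))) 0<vy)
  where
    u*v≡0 : ∀ z′ y′ c → f z′ ≡ just c → f y′ ≡ just c → pointMass z z′ * v y′ ≡ 0ℚ
    u*v≡0 z′ y′ c fz′≡c fy′≡c with z′ ≟ʷ z
    ... | no  _    = *-zeroˡ (v y′)
    ... | yes refl = trans (cong (1ℚ *_) (v-sameValue y′ (trans fy′≡c (trans (sym fz′≡c) fz≡a)))) (*-zeroˡ 1ℚ)

pointMassPair-admissible : ∀ {g n h} (f : PFun g n h) {x y : Word g n} {a b : Fin h} →
  f x ≡ just a → f y ≡ just b → a ≢ b → Admissible f (pointMass x) (pointMass y)
pointMassPair-admissible f {x} {y} {a} fx≡a fy≡b a≢b =
  pointMass-admissible f fx≡a (pointMass-nonneg y) (λ _ → pointMass-undefined f fy≡b) v-sameValue y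
    (subst (0ℚ <_) (sym (pointMass-self y)) 0<1)
  where
    v-sameValue : ∀ y′ → f y′ ≡ just a → pointMass y y′ ≡ 0ℚ
    v-sameValue y′ fy′≡a with y′ ≟ʷ y
    ... | no  _    = refl
    ... | yes refl = ⊥-elim (a≢b (Maybe.just-injective (trans (sym fy′≡a) fy≡b)))

adversaryBound-nonpos : ∀ {g n} (u : Word g n → ℚ) {v : Word g n → ℚ} {c : ℚ} →
  (∀ y → 0ℚ ≤ v y) → c ≤ 0ℚ → AdversaryBound u v c
adversaryBound-nonpos {g} {n} u v≥0 c≤0 x y i _ _ =
  ≤-trans c≤0 (p≤q⇒p≤q⊔r _ (/ₜ-nonneg (Σ-nonneg (allWords g n) v≥0)
    (Σ∣-nonneg (allWords g n) (λ y′ → not ⌊ lookup x i ≟ᶠ lookup y′ i ⌋) v≥0)))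

sensPartner-undefined : ∀ {g n h} (f : PFun g n h) x y → f y ≡ nothing → sensPartner f x y ≡ false
sensPartner-undefined f x y fy≡nothing with f y
... | nothing = refl

sensPartner-sameValue : ∀ {g n h} (f : PFun g n h) x y → f y ≡ f x → sensPartner f x y ≡ false
sensPartner-sameValue f x y fy≡fx with f y
... | nothing = refl
... | just b  = cong not (⌊⌋-true (Maybe.≡-dec _≟ᶠ_ (just b) (f x)) fy≡fx)

module PartnerWeights {g n h : ℕ} (f : PFun g n h) (x : Word g n) (w : Block n → ℚ) where

  isPartnerWith : Word g n → Block n → Bool
  isPartnerWith y B = sensPartner f x y ∧ ⌊ diff x y ≟ᵇ B ⌋

  multiplicity : Block n → ℚ
  multiplicity B = count (allWords g n) (λ y → isPartnerWith y B)

  partnerWeight : Word g n → ℚ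
  partnerWeight y = if sensPartner f x y then w (diff x y) /ₜ multiplicity (diff x y) else 0ℚ

  partner-sensitive : ∀ y → sensPartner f x y ≡ true → isSensitive f x (diff x y) ≡ true
  partner-sensitive y partner = any-true (allWords g n) (λ y′ → isPartnerWith y′ (diff x y)) (∈-allWords y)
    (cong₂ _∧_ partner (⌊⌋-true (diff x y ≟ᵇ diff x y) refl))

  partnerWeight-nonneg : (∀ B → isSensitive f x B ≡ true → 0ℚ ≤ w B) → ∀ y → 0ℚ ≤ partnerWeight y
  partnerWeight-nonneg w≥0 y with sensPartner f x y in partner
  ... | false = ≤-refl
  ... | true  = /ₜ-nonneg (w≥0 (diff x y) (partner-sensitive y partner))
                          (Σ∣-nonneg (allWords g n) (λ y′ → isPartnerWith y′ (diff x y)) (λ _ → <⇒≤ 0<1))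

  partnerWeight-undefined : ∀ y → f y ≡ nothing → partnerWeight y ≡ 0ℚ
  partnerWeight-undefined y fy≡nothing =
    cong (if_then w (diff x y) /ₜ multiplicity (diff x y) else 0ℚ) (sensPartner-undefined f x y fy≡nothing)

  partnerWeight-sameValue : ∀ y → f y ≡ f x → partnerWeight y ≡ 0ℚ
  partnerWeight-sameValue y fy≡fx =
    cong (if_then w (diff x y) /ₜ multiplicity (diff x y) else 0ℚ) (sensPartner-sameValue f x y fy≡fx)

  Σ-partnerWeight : ∀ (P : Block n → Bool) →
    Σ[ allWords g n ∣ (λ y → P (diff x y)) ] partnerWeight ≡ Σ[ sensBlocks f x ∣ P ] w
  Σ-partnerWeight P = begin
    Σ[ Ws ] (λ y → if P (diff x y) then partnerWeight y else 0ℚ)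
      ≡⟨ Σ-cong Ws share-by-block ⟩
    Σ[ Ws ] (λ y → Σ[ Bs ∣ isPartnerWith y ] share)
      ≡⟨ Σ-comm Ws Bs (λ y B → if isPartnerWith y B then share B else 0ℚ) ⟩
    Σ[ Bs ] (λ B → Σ[ Ws ∣ (λ y → isPartnerWith y B) ] (λ _ → share B))
      ≡⟨ Σ-cong Bs (λ B → Σ∣-const Ws (λ y → isPartnerWith y B) (share B)) ⟩
    Σ[ Bs ] (λ B → share B * multiplicity B)
      ≡⟨ Σ-cong Bs share*multiplicity ⟩
    Σ[ Bs ∣ isSensitive f x ] (λ B → if P B then w B else 0ℚ)
      ≡⟨ sym (Σ∣-filter Bs (isSensitive f x) P w) ⟩
    Σ[ sensBlocks f x ∣ P ] w ∎
    where
      open ≡-Reasoning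
      Ws = allWords g n
      Bs = allBlocks n

      share : Block n → ℚ
      share B = if P B then w B /ₜ multiplicity B else 0ℚ

      share-by-block : ∀ y → (if P (diff x y) then partnerWeight y else 0ℚ) ≡ Σ[ Bs ∣ isPartnerWith y ] share
      share-by-block y with sensPartner f x y
      ... | true  = sym (Σ-allBlocks-select (diff x y) share)
      ... | false = trans (if-same (P (diff x y))) (sym (Σ-zero Bs (λ _ → refl)))
        where if-same : ∀ b → (if b then 0ℚ else 0ℚ) ≡ 0ℚ
              if-same true  = refl
              if-same false = refl

      share*multiplicity : ∀ B → share B * multiplicity B ≡ (if isSensitive f x B then (if P B then w B else 0ℚ) else 0ℚ)
      share*multiplicity B with isSensitive f x B in sensitive
      ... | false = trans (cong (share B *_) (count≡0 Ws (λ y → isPartnerWith y B) sensitive)) (*-zeroʳ (share B))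
      ... | true with P B
      ...   | true  = /ₜ-*-cancel (w B) (≢-sym (<⇒≢ (count>0 Ws (λ y → isPartnerWith y B) sensitive)))
      ...   | false = *-zeroˡ (multiplicity B)

  Σ-partnerWeight-total : Σ[ allWords g n ] partnerWeight ≡ blockValue f x w
  Σ-partnerWeight-total = Σ-partnerWeight (λ _ → true)

  Σ-partnerWeight-differingAt : ∀ i →
    Σ[ allWords g n ∣ (λ y → not ⌊ lookup x i ≟ᶠ lookup y i ⌋) ] partnerWeight ≡ Σ[ sensBlocks f x ∣ (λ B → i ∈B B) ] w
  Σ-partnerWeight-differingAt i =
    trans (Σ-cong (allWords g n) (λ y → cong (if_then partnerWeight y else 0ℚ) (sym (Vec.lookup-zipWith _ i x y))))
          (Σ-partnerWeight (λ B → i ∈B B))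

  blockValue≤θˣ : FeasibleWeight f x w → ∀ i y → 0ℚ < partnerWeight y → lookup x i ≢ lookup y i →
                  blockValue f x w ≤ θˣ partnerWeight x i
  blockValue≤θˣ (w-bounds , load≤1) i y 0<vy xᵢ≢yᵢ =
    subst (_≤ (Σ[ allWords g n ] partnerWeight) /ₜ D) Σ-partnerWeight-total
      (≤-/ₜ (Σ-nonneg (allWords g n) v≥0) 0<D D≤1)
    where
      v≥0 : ∀ y′ → 0ℚ ≤ partnerWeight y′
      v≥0 = partnerWeight-nonneg (λ B sensitive → proj₁ (w-bounds B sensitive))
      differsAtI : Word g n → Bool
      differsAtI y′ = not ⌊ lookup x i ≟ᶠ lookup y′ i ⌋
      D : ℚ
      D = Σ[ allWords g n ∣ differsAtI ] partnerWeight
      D≤1 : D ≤ 1ℚ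
      D≤1 = subst (_≤ 1ℚ) (sym (Σ-partnerWeight-differingAt i)) (load≤1 i)
      0<D : 0ℚ < D
      0<D = <-≤-trans 0<vy (term≤Σ∣ (allWords g n) differsAtI v≥0 (∈-allWords y) (cong not (⌊⌋-false (lookup x i ≟ᶠ lookup y i) xᵢ≢yᵢ)))

  partnerWeight-adversaryBound : FeasibleWeight f x w → AdversaryBound (pointMass x) partnerWeight (blockValue f x w)
  partnerWeight-adversaryBound feas x′ y i 0<uv xᵢ≢yᵢ with pointMass-support x x′ 0<uv
  ... | refl = p≤q⇒p≤q⊔r _ (blockValue≤θˣ feas i y 0<vy xᵢ≢yᵢ)
    where 0<vy : 0ℚ < partnerWeight y
          0<vy = subst (0ℚ <_) (pointMass-self-* x (partnerWeight y)) 0<uv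

proposition2 : (g n h : ℕ) (f : PFun g n h) → NonConstant f →
    ∀ (x : Word g n) (a : Fin h) → f x ≡ just a →
    ∀ (w : Block n → ℚ) → FeasibleWeight f x w →
    ∃ λ (u : Word g n → ℚ) → ∃ λ (v : Word g n → ℚ) →
      Admissible f u v × AdversaryBound u v (blockValue f x w)
proposition2 g n h f (x₀ , y₀ , a₀ , b₀ , fx₀≡a₀ , fy₀≡b₀ , a₀≢b₀) x a fx≡a w feas@(w-bounds , _) =
  byTotalWeight (0ℚ <? Σ[ allWords g n ] partnerWeight)
  where
    open PartnerWeights f x w
    v≥0 : ∀ y → 0ℚ ≤ partnerWeight y
    v≥0 = partnerWeight-nonneg (λ B sensitive → proj₁ (w-bounds B sensitive))
    byTotalWeight : Dec (0ℚ < Σ[ allWords g n ] partnerWeight) → ∃ λ (u : Word g n → ℚ) → ∃ λ (v : Word g n → ℚ) →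
                    Admissible f u v × AdversaryBound u v (blockValue f x w)
    byTotalWeight (yes 0<Σv) =
      let (y , 0<vy) = Σ>0⇒term>0 (allWords g n) partnerWeight 0<Σv in
      pointMass x , partnerWeight ,
      pointMass-admissible f fx≡a v≥0 partnerWeight-undefined
        (λ y′ fy′≡a → partnerWeight-sameValue y′ (trans fy′≡a (sym fx≡a))) y 0<vy ,
      partnerWeight-adversaryBound feas
    byTotalWeight (no 0≮Σv) =
      pointMass x₀ , pointMass y₀ , pointMassPair-admissible f fx₀≡a₀ fy₀≡b₀ a₀≢b₀ ,
      adversaryBound-nonpos (pointMass x₀) (pointMass-nonneg y₀)
        (subst (_≤ 0ℚ) Σ-partnerWeight-total (≮⇒≥ 0≮Σv))
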